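{- Let $b\ge2$. For any $(2b+1,b)$-coloring $\varphi$ of the path $P^4$ (vertices $v_0,\ldots,v_4$), there exist four distinct $b$-subsets $X_1,X_2,X_3,X_4$ of $\{1,\ldots,2b+1\}$ such that (i) $|X_1\cap X_2|=|X_1\cap X_3|=b-1$ and $|X_1\cap X_4|=b-2$, and (ii) for each $i\in\{1,2,3,4\}$ there exists a $(2b+1,b)$-coloring $\varphi'$ of $P^4$ with $\varphi'(v_0)=\varphi(v_0)$, $\varphi'(v_4)=\varphi(v_4)$ and $\varphi'(v_2)=X_i$.
   Context: A $(2b+1,b)$-coloring of a graph assigns to each vertex a $b$-subset of $\{1,\ldots,2b+1\}$ so that adjacent vertices receive disjoint sets. $P^n$ is the path with vertices $v_0,\ldots,v_n$ and edges $v_iv_{i+1}$. -}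

module Defs where

open import Data.Nat using (ℕ; suc; _+_; _*_)
open import Data.Fin using (Fin; zero; suc; inject₁)
open import Data.Fin.Subset using (Subset; ∣_∣; _∩_; ⊥)
open import Data.Product using (_×_)
open import Relation.Binary.PropositionalEquality using (_≡_)

IsBSubset : {n : ℕ} → ℕ → Subset n → Set
IsBSubset b X = ∣ X ∣ ≡ b

-- Path P^m: vertices v_0,…,v_m (Fin (suc m)), edges v_i v_{i+1}.
-- A (2b+1,b)-coloring of P^m.
IsColoring : (b m : ℕ) → (Fin (suc m) → Subset (suc (2 * b))) → Set
IsColoring b m φ =
  ((v : Fin (suc m)) → IsBSubset b (φ v)) ×
  ((i : Fin m) → (φ (inject₁ i) ∩ φ (suc i)) ≡ ⊥)

-- Let A = φ(v₀), B = φ(v₄) and k = |A ∩ B|. Two b-subsets of the 2b+1 colours have a common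
-- disjoint b-subset exactly when their union has at most b+1 colours, i.e. when they share at
-- least b−1 colours. Hence a b-set X can colour v₂ between A and B iff |X ∩ A| ≥ b−1 and
-- |X ∩ B| ≥ b−1, and applied to φ(v₂) this forces k ≥ b−2. The four sets are built from
-- exchanges A − x + y (x ∈ A, y ∉ A), whose intersections are all governed by the single count
-- |(A − x + y) ∩ Z| + [x ∈ Z] = |A ∩ Z| + [y ∈ Z]: the square A − xᵢ + yⱼ (i, j ∈ {1, 2}) with
-- xᵢ ∈ A ∩ B, yⱼ ∉ A ∪ B if k = b and with xᵢ ∈ A ∖ B, yⱼ ∈ B ∖ A if k = b−2; and, if k = b−1,
-- the set A itself together with A − a + y, A − a + c, A − i + c, where A ∖ B = {a}, B ∖ A = {c},
-- i ∈ A ∩ B and y ∉ A ∪ B.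
module Submission where

open import Defs

open import Algebra.Properties.CommutativeSemigroup using (xy∙z≈xz∙y)
open import Data.Bool using (_∧_; not)
open import Data.Bool.Properties using (∧-conicalˡ; ∧-conicalʳ; not-injective)
open import Data.Fin using (Fin; zero; suc; inject₁)
import Data.Fin.Properties as Fin
open import Data.Fin.Subset
open import Data.Fin.Subset.Properties
open import Data.Nat using (ℕ; zero; suc; _+_; _*_; _∸_; _≤_; _<_; z≤n; s≤s; s≤s⁻¹)
open import Data.Nat.Properties
open import Data.Product using (Σ-syntax; ∃-syntax; _×_; _,_; proj₁; proj₂)
open import Data.Sum using (inj₁; inj₂)
open import Data.Vec using ([]; _∷_; lookup; _[_]≔_)
open import Data.Vec.Properties using (lookup-map; lookup-zipWith; lookup∘update; lookup∘update′; lookup-replicate)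
open import Data.Vec.Relation.Unary.All using ([]; _∷_)
import Data.Vec.Relation.Unary.All.Properties as All
open import Data.Vec.Relation.Unary.AllPairs using ([]; _∷_)
open import Data.Vec.Relation.Unary.Unique.Propositional using (Unique)
open import Data.Vec.Relation.Unary.Unique.Propositional.Properties using (lookup-injective)
open import Function using (_∘_)
open import Relation.Binary.PropositionalEquality

private variable
  n : ℕ

∣p∪q∣+∣p∩q∣≡∣p∣+∣q∣ : (p q : Subset n) → ∣ p ∪ q ∣ + ∣ p ∩ q ∣ ≡ ∣ p ∣ + ∣ q ∣
∣p∪q∣+∣p∩q∣≡∣p∣+∣q∣ []            []            = refl
∣p∪q∣+∣p∩q∣≡∣p∣+∣q∣ (inside ∷ p)  (inside ∷ q)  =
  cong suc (trans (+-suc _ _) (trans (cong suc (∣p∪q∣+∣p∩q∣≡∣p∣+∣q∣ p q)) (sym (+-suc _ _))))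
∣p∪q∣+∣p∩q∣≡∣p∣+∣q∣ (inside ∷ p)  (outside ∷ q) = cong suc (∣p∪q∣+∣p∩q∣≡∣p∣+∣q∣ p q)
∣p∪q∣+∣p∩q∣≡∣p∣+∣q∣ (outside ∷ p) (inside ∷ q)  = trans (cong suc (∣p∪q∣+∣p∩q∣≡∣p∣+∣q∣ p q)) (sym (+-suc _ _))
∣p∪q∣+∣p∩q∣≡∣p∣+∣q∣ (outside ∷ p) (outside ∷ q) = ∣p∪q∣+∣p∩q∣≡∣p∣+∣q∣ p q

∣p∩q∣+∣p∩∁q∣≡∣p∣ : (p q : Subset n) → ∣ p ∩ q ∣ + ∣ p ∩ ∁ q ∣ ≡ ∣ p ∣
∣p∩q∣+∣p∩∁q∣≡∣p∣ []            []            = refl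
∣p∩q∣+∣p∩∁q∣≡∣p∣ (inside ∷ p)  (inside ∷ q)  = cong suc (∣p∩q∣+∣p∩∁q∣≡∣p∣ p q)
∣p∩q∣+∣p∩∁q∣≡∣p∣ (inside ∷ p)  (outside ∷ q) = trans (+-suc _ _) (cong suc (∣p∩q∣+∣p∩∁q∣≡∣p∣ p q))
∣p∩q∣+∣p∩∁q∣≡∣p∣ (outside ∷ p) (_ ∷ q)       = ∣p∩q∣+∣p∩∁q∣≡∣p∣ p q

∩≡⊥⇒∣p∣+∣q∣≤n : (p q : Subset n) → p ∩ q ≡ ⊥ → ∣ p ∣ + ∣ q ∣ ≤ n
∩≡⊥⇒∣p∣+∣q∣≤n {n} p q p∩q≡⊥ = begin
  ∣ p ∣ + ∣ q ∣          ≡⟨ sym (∣p∪q∣+∣p∩q∣≡∣p∣+∣q∣ p q) ⟩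
  ∣ p ∪ q ∣ + ∣ p ∩ q ∣  ≡⟨ cong (λ r → ∣ p ∪ q ∣ + ∣ r ∣) p∩q≡⊥ ⟩
  ∣ p ∪ q ∣ + ∣ ⊥ {n} ∣  ≡⟨ cong (∣ p ∪ q ∣ +_) (∣⊥∣≡0 n) ⟩
  ∣ p ∪ q ∣ + 0          ≡⟨ +-identityʳ _ ⟩
  ∣ p ∪ q ∣              ≤⟨ ∣p∣≤n (p ∪ q) ⟩
  n                      ∎
  where open ≤-Reasoning

∣p∩r∣+∣r∩q∣≤∣r∣+∣p∩q∣ : (p q r : Subset n) → ∣ p ∩ r ∣ + ∣ r ∩ q ∣ ≤ ∣ r ∣ + ∣ p ∩ q ∣
∣p∩r∣+∣r∩q∣≤∣r∣+∣p∩q∣ p q r = begin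
  ∣ p ∩ r ∣ + ∣ r ∩ q ∣                      ≡⟨ cong (λ s → ∣ s ∣ + ∣ r ∩ q ∣) (∩-comm p r) ⟩
  ∣ r ∩ p ∣ + ∣ r ∩ q ∣                      ≡⟨ sym (∣p∪q∣+∣p∩q∣≡∣p∣+∣q∣ (r ∩ p) (r ∩ q)) ⟩
  ∣ r ∩ p ∪ r ∩ q ∣ + ∣ (r ∩ p) ∩ (r ∩ q) ∣  ≤⟨ +-mono-≤ (p⊆q⇒∣p∣≤∣q∣ union⊆r) (p⊆q⇒∣p∣≤∣q∣ meet⊆p∩q) ⟩
  ∣ r ∣ + ∣ p ∩ q ∣                          ∎
  where
  open ≤-Reasoning
  union⊆r : r ∩ p ∪ r ∩ q ⊆ r
  union⊆r = subst (_⊆ r) (∩-distribˡ-∪ r p q) (p∩q⊆p r (p ∪ q))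
  meet⊆p∩q : (r ∩ p) ∩ (r ∩ q) ⊆ p ∩ q
  meet⊆p∩q x∈ = let x∈rp , x∈rq = x∈p∩q⁻ _ _ x∈ in
    x∈p∩q⁺ (proj₂ (x∈p∩q⁻ r p x∈rp) , proj₂ (x∈p∩q⁻ r q x∈rq))

⊆∁⇒∩≡⊥ : {p q : Subset n} → q ⊆ ∁ p → p ∩ q ≡ ⊥
⊆∁⇒∩≡⊥ {p = p} {q} q⊆∁p = Empty-unique λ (x , x∈p∩q) →
  let x∈p , x∈q = x∈p∩q⁻ p q x∈p∩q in x∈p⇒x∉∁p x∈p (q⊆∁p x∈q)

∣p∩q∣<∣p∣⇒p≢q : {p q : Subset n} → ∣ p ∩ q ∣ < ∣ p ∣ → p ≢ q
∣p∩q∣<∣p∣⇒p≢q {p = p} ∣p∩q∣<∣p∣ refl = <⇒≢ ∣p∩q∣<∣p∣ (cong ∣_∣ (∩-idem p))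

∃-⊆-of-size : ∀ {k} (p : Subset n) → k ≤ ∣ p ∣ → ∃[ q ] (q ⊆ p × ∣ q ∣ ≡ k)
∃-⊆-of-size []            z≤n = [] , ⊆-refl , refl
∃-⊆-of-size (outside ∷ p) k≤∣p∣ with ∃-⊆-of-size p k≤∣p∣
... | q , q⊆p , ∣q∣≡k = outside ∷ q , out⊆ q⊆p , ∣q∣≡k
∃-⊆-of-size {n = suc n} {k = zero} (inside ∷ p) _ = ⊥ , ⊥⊆ , ∣⊥∣≡0 n
∃-⊆-of-size {k = suc k} (inside ∷ p) (s≤s k≤∣p∣) with ∃-⊆-of-size p k≤∣p∣
... | q , q⊆p , ∣q∣≡k = inside ∷ q , in⊆in q⊆p , cong suc ∣q∣≡k

∃-inside : (p : Subset n) → 1 ≤ ∣ p ∣ → ∃[ x ] lookup p x ≡ inside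
∃-inside (inside ∷ p)  _   = zero , refl
∃-inside (outside ∷ p) 1≤∣p∣ with ∃-inside p 1≤∣p∣
... | x , px = suc x , px

∃₂-inside : (p : Subset n) → 2 ≤ ∣ p ∣ → ∃[ x ] ∃[ y ] (x ≢ y × lookup p x ≡ inside × lookup p y ≡ inside)
∃₂-inside (inside ∷ p) (s≤s 1≤∣p∣) with ∃-inside p 1≤∣p∣
... | y , py = zero , suc y , (λ ()) , refl , py
∃₂-inside (outside ∷ p) 2≤∣p∣ with ∃₂-inside p 2≤∣p∣
... | x , y , x≢y , px , py = suc x , suc y , x≢y ∘ Fin.suc-injective , px , py

lookup-∩ : (p q : Subset n) (i : Fin n) → lookup (p ∩ q) i ≡ lookup p i ∧ lookup q i
lookup-∩ p q i = lookup-zipWith _∧_ i p q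

≢-indices : {p : Subset n} {x y : Fin n} → lookup p x ≡ inside → lookup p y ≡ outside → x ≢ y
≢-indices px py refl with trans (sym px) py
... | ()

≢-subsets : {p q : Subset n} {x : Fin n} → lookup p x ≡ inside → lookup q x ≡ outside → p ≢ q
≢-subsets px qx refl with trans (sym px) qx
... | ()

region : Side → Subset n → Subset n
region inside  p = p
region outside p = ∁ p

lookup-region : ∀ s (p : Subset n) x → lookup (region s p) x ≡ inside → lookup p x ≡ s
lookup-region inside  p x px  = px
lookup-region outside p x ∁px = not-injective (trans (sym (lookup-map x not p)) ∁px)

module _ (p q : Subset n) (s t : Side) where

  InRegions : Fin n → Set
  InRegions x = lookup p x ≡ s × lookup q x ≡ t

  inRegions : ∀ x → lookup (region s p ∩ region t q) x ≡ inside → InRegions x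
  inRegions x x∈ = lookup-region s p x (∧-conicalˡ _ _ x∈′) , lookup-region t q x (∧-conicalʳ _ _ x∈′)
    where x∈′ = trans (sym (lookup-∩ (region s p) (region t q) x)) x∈

  ∃-inRegions : 1 ≤ ∣ region s p ∩ region t q ∣ → ∃[ x ] InRegions x
  ∃-inRegions 1≤ = let x , x∈ = ∃-inside (region s p ∩ region t q) 1≤ in x , inRegions x x∈

  ∃₂-inRegions : 2 ≤ ∣ region s p ∩ region t q ∣ → ∃[ x ] ∃[ x′ ] (x ≢ x′ × InRegions x × InRegions x′)
  ∃₂-inRegions 2≤ = let x , x′ , x≢x′ , x∈ , x′∈ = ∃₂-inside (region s p ∩ region t q) 2≤ in
    x , x′ , x≢x′ , inRegions x x∈ , inRegions x′ x′∈

χ : Side → ℕ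
χ inside  = 1
χ outside = 0

∣p[i]≔v∣ : (p : Subset n) (i : Fin n) (v : Side) → ∣ p [ i ]≔ v ∣ + χ (lookup p i) ≡ ∣ p ∣ + χ v
∣p[i]≔v∣ (inside  ∷ p) zero inside  = refl
∣p[i]≔v∣ (inside  ∷ p) zero outside = +-suc ∣ p ∣ 0
∣p[i]≔v∣ (outside ∷ p) zero inside  = sym (+-suc ∣ p ∣ 0)
∣p[i]≔v∣ (outside ∷ p) zero outside = refl
∣p[i]≔v∣ (inside  ∷ p) (suc i) v    = cong suc (∣p[i]≔v∣ p i v)
∣p[i]≔v∣ (outside ∷ p) (suc i) v    = ∣p[i]≔v∣ p i v

[]≔-∩ : (p q : Subset n) (i : Fin n) (v : Side) → (p [ i ]≔ v) ∩ q ≡ (p ∩ q) [ i ]≔ (v ∧ lookup q i)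
[]≔-∩ (x ∷ p) (y ∷ q) zero    v = refl
[]≔-∩ (x ∷ p) (y ∷ q) (suc i) v = cong ((x ∧ y) ∷_) ([]≔-∩ p q i v)

exchange : Subset n → Fin n → Fin n → Subset n
exchange p x y = p [ x ]≔ outside [ y ]≔ inside

lookup-exchange-added : (p : Subset n) (x y : Fin n) → lookup (exchange p x y) y ≡ inside
lookup-exchange-added p x y = lookup∘update y (p [ x ]≔ outside) inside

lookup-exchange-other : (p : Subset n) (x y : Fin n) {z : Fin n} → z ≢ x → z ≢ y →
                        lookup (exchange p x y) z ≡ lookup p z
lookup-exchange-other p x y z≢x z≢y =
  trans (lookup∘update′ z≢y (p [ x ]≔ outside) inside) (lookup∘update′ z≢x p outside)

module _ (p : Subset n) (x y : Fin n) (px : lookup p x ≡ inside) (py : lookup p y ≡ outside) where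

  lookup-exchange-removed : lookup (exchange p x y) x ≡ outside
  lookup-exchange-removed =
    trans (lookup∘update′ (≢-indices {p = p} px py) (p [ x ]≔ outside) inside) (lookup∘update x p outside)

  ∣exchange∩q∣ : ∀ q {s t} → lookup q x ≡ s → lookup q y ≡ t → ∣ exchange p x y ∩ q ∣ + χ s ≡ ∣ p ∩ q ∣ + χ t
  ∣exchange∩q∣ q refl refl = begin
    ∣ exchange p x y ∩ q ∣ + χ (lookup q x)        ≡⟨ cong (_+ χ (lookup q x)) ∣exchange∩q∣≡∣r∣+χqy ⟩
    ∣ r ∣ + χ (lookup q y) + χ (lookup q x)        ≡⟨ xy∙z≈xz∙y +-commutativeSemigroup ∣ r ∣ _ _ ⟩
    ∣ r ∣ + χ (lookup q x) + χ (lookup q y)        ≡⟨ cong (λ s → ∣ r ∣ + χ s + χ (lookup q y)) (sym p∩q[x]≡q[x]) ⟩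
    ∣ r ∣ + χ (lookup (p ∩ q) x) + χ (lookup q y)  ≡⟨ cong (_+ χ (lookup q y)) (∣p[i]≔v∣ (p ∩ q) x outside) ⟩
    ∣ p ∩ q ∣ + 0 + χ (lookup q y)                 ≡⟨ cong (_+ χ (lookup q y)) (+-identityʳ ∣ p ∩ q ∣) ⟩
    ∣ p ∩ q ∣ + χ (lookup q y)                     ∎
    where
    open ≡-Reasoning
    r = (p ∩ q) [ x ]≔ outside
    p∩q[x]≡q[x] : lookup (p ∩ q) x ≡ lookup q x
    p∩q[x]≡q[x] = trans (lookup-∩ p q x) (cong (_∧ lookup q x) px)
    ry≡outside : lookup r y ≡ outside
    ry≡outside = trans (lookup∘update′ (≢-indices {p = p} px py ∘ sym) (p ∩ q) outside)
                       (trans (lookup-∩ p q y) (cong (_∧ lookup q y) py))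
    ∣exchange∩q∣≡∣r∣+χqy : ∣ exchange p x y ∩ q ∣ ≡ ∣ r ∣ + χ (lookup q y)
    ∣exchange∩q∣≡∣r∣+χqy = begin
      ∣ exchange p x y ∩ q ∣                    ≡⟨ cong ∣_∣ (trans ([]≔-∩ (p [ x ]≔ outside) q y inside)
                                                                   (cong (_[ y ]≔ lookup q y) ([]≔-∩ p q x outside))) ⟩
      ∣ r [ y ]≔ lookup q y ∣                   ≡⟨ sym (+-identityʳ _) ⟩
      ∣ r [ y ]≔ lookup q y ∣ + χ outside       ≡⟨ cong (λ s → ∣ r [ y ]≔ lookup q y ∣ + χ s) (sym ry≡outside) ⟩
      ∣ r [ y ]≔ lookup q y ∣ + χ (lookup r y)  ≡⟨ ∣p[i]≔v∣ r y (lookup q y) ⟩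
      ∣ r ∣ + χ (lookup q y)                    ∎

  exchange-∩-keeps : ∀ q → lookup q x ≡ lookup q y → ∣ exchange p x y ∩ q ∣ ≡ ∣ p ∩ q ∣
  exchange-∩-keeps q qx≡qy = +-cancelʳ-≡ (χ (lookup q x)) _ _ (∣exchange∩q∣ q refl (sym qx≡qy))

  exchange-∩-gains : ∀ q → lookup q x ≡ outside → lookup q y ≡ inside → ∣ exchange p x y ∩ q ∣ ≡ suc ∣ p ∩ q ∣
  exchange-∩-gains q qx qy = trans (sym (+-identityʳ _)) (trans (∣exchange∩q∣ q qx qy) (+-comm _ 1))

  exchange-∩-loses : ∀ q → lookup q x ≡ inside → lookup q y ≡ outside → suc ∣ exchange p x y ∩ q ∣ ≡ ∣ p ∩ q ∣
  exchange-∩-loses q qx qy = trans (+-comm 1 _) (trans (∣exchange∩q∣ q qx qy) (+-identityʳ _))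

  ∣exchange∣ : ∣ exchange p x y ∣ ≡ ∣ p ∣
  ∣exchange∣ = begin
    ∣ exchange p x y ∣          ≡⟨ cong ∣_∣ (sym (∩-identityʳ (exchange p x y))) ⟩
    ∣ exchange p x y ∩ ⊤ {n} ∣  ≡⟨ exchange-∩-keeps ⊤ (trans (lookup-replicate x inside)
                                                            (sym (lookup-replicate y inside))) ⟩
    ∣ p ∩ ⊤ ∣                   ≡⟨ cong ∣_∣ (∩-identityʳ p) ⟩
    ∣ p ∣                       ∎
    where open ≡-Reasoning

  1+∣exchange∩p∣ : suc ∣ exchange p x y ∩ p ∣ ≡ ∣ p ∣
  1+∣exchange∩p∣ = trans (exchange-∩-loses p px py) (cong ∣_∣ (∩-idem p))

module _ {b : ℕ} {p q : Subset (suc (2 * b))} (∣p∣≡b : ∣ p ∣ ≡ b) (∣q∣≡b : ∣ q ∣ ≡ b) where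

  private
    ∣p∪q∣+∣p∩q∣≡b+b : ∣ p ∪ q ∣ + ∣ p ∩ q ∣ ≡ b + b
    ∣p∪q∣+∣p∩q∣≡b+b = trans (∣p∪q∣+∣p∩q∣≡∣p∣+∣q∣ p q) (cong₂ _+_ ∣p∣≡b ∣q∣≡b)

  common-neighbour⇒overlap : (u : Subset (suc (2 * b))) → ∣ u ∣ ≡ b → p ∩ u ≡ ⊥ → u ∩ q ≡ ⊥ →
                             b ≤ suc ∣ p ∩ q ∣
  common-neighbour⇒overlap u ∣u∣≡b p∩u≡⊥ u∩q≡⊥ = +-cancelˡ-≤ b _ _ (begin
    b + b                  ≡⟨ sym ∣p∪q∣+∣p∩q∣≡b+b ⟩
    ∣ p ∪ q ∣ + ∣ p ∩ q ∣  ≤⟨ +-monoˡ-≤ _ ∣p∪q∣≤1+b ⟩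
    suc b + ∣ p ∩ q ∣      ≡⟨ sym (+-suc b _) ⟩
    b + suc ∣ p ∩ q ∣      ∎)
    where
    open ≤-Reasoning
    p∪q∩u≡⊥ : (p ∪ q) ∩ u ≡ ⊥
    p∪q∩u≡⊥ = trans (∩-distribʳ-∪ u p q) (trans (cong₂ _∪_ p∩u≡⊥ (trans (∩-comm q u) u∩q≡⊥)) (∪-identityˡ ⊥))
    ∣p∪q∣≤1+b : ∣ p ∪ q ∣ ≤ suc b
    ∣p∪q∣≤1+b = +-cancelʳ-≤ b _ _ (begin
      ∣ p ∪ q ∣ + b      ≡⟨ cong (∣ p ∪ q ∣ +_) (sym ∣u∣≡b) ⟩
      ∣ p ∪ q ∣ + ∣ u ∣  ≤⟨ ∩≡⊥⇒∣p∣+∣q∣≤n (p ∪ q) u p∪q∩u≡⊥ ⟩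
      suc (b + (b + 0))  ≡⟨ cong (λ k → suc (b + k)) (+-identityʳ b) ⟩
      suc b + b          ∎)

  overlap⇒common-neighbour : b ≤ suc ∣ p ∩ q ∣ → ∃[ u ] (∣ u ∣ ≡ b × p ∩ u ≡ ⊥ × q ∩ u ≡ ⊥)
  overlap⇒common-neighbour b≤1+∣p∩q∣ =
    let u , u⊆∁p∪q , ∣u∣≡b = ∃-⊆-of-size (∁ (p ∪ q)) b≤∣∁p∪q∣ in
    u , ∣u∣≡b , ⊆∁⇒∩≡⊥ (⊆-trans u⊆∁p∪q (p⊆q⇒∁p⊇∁q (p⊆p∪q q))) , ⊆∁⇒∩≡⊥ (⊆-trans u⊆∁p∪q (p⊆q⇒∁p⊇∁q (q⊆p∪q p q)))
    where
    open ≤-Reasoning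
    ∣p∪q∣≤1+b : ∣ p ∪ q ∣ ≤ suc b
    ∣p∪q∣≤1+b = +-cancelʳ-≤ b _ _ (begin
      ∣ p ∪ q ∣ + b                ≤⟨ +-monoʳ-≤ ∣ p ∪ q ∣ b≤1+∣p∩q∣ ⟩
      ∣ p ∪ q ∣ + suc ∣ p ∩ q ∣    ≡⟨ +-suc _ _ ⟩
      suc (∣ p ∪ q ∣ + ∣ p ∩ q ∣)  ≡⟨ cong suc ∣p∪q∣+∣p∩q∣≡b+b ⟩
      suc b + b                    ∎)
    b≤∣∁p∪q∣ : b ≤ ∣ ∁ (p ∪ q) ∣
    b≤∣∁p∪q∣ = begin
      b                        ≡⟨ sym (trans (m+n∸m≡n b (b + 0)) (+-identityʳ b)) ⟩
      suc (2 * b) ∸ suc b      ≤⟨ ∸-monoʳ-≤ (suc (2 * b)) ∣p∪q∣≤1+b ⟩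
      suc (2 * b) ∸ ∣ p ∪ q ∣  ≡⟨ sym (∣∁p∣≡n∸∣p∣ (p ∪ q)) ⟩
      ∣ ∁ (p ∪ q) ∣            ∎

module _ {b : ℕ} where

  end-colours-overlap : (φ : Fin 5 → Subset (suc (2 * b))) → IsColoring b 4 φ →
                        b ≤ suc (suc ∣ φ zero ∩ φ (suc (suc (suc (suc zero)))) ∣)
  end-colours-overlap φ (size , edge) = +-cancelˡ-≤ b _ _ (begin
    b + b                              ≤⟨ +-mono-≤ b≤1+∣A∩w∣ b≤1+∣w∩B∣ ⟩
    suc ∣ A ∩ w ∣ + suc ∣ w ∩ B ∣      ≡⟨ cong suc (+-suc _ _) ⟩
    suc (suc (∣ A ∩ w ∣ + ∣ w ∩ B ∣))  ≤⟨ s≤s (s≤s (∣p∩r∣+∣r∩q∣≤∣r∣+∣p∩q∣ A B w)) ⟩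
    suc (suc (∣ w ∣ + ∣ A ∩ B ∣))      ≡⟨ cong (λ k → suc (suc (k + ∣ A ∩ B ∣))) (size (suc (suc zero))) ⟩
    suc (suc (b + ∣ A ∩ B ∣))          ≡⟨ sym (trans (+-suc b _) (cong suc (+-suc b _))) ⟩
    b + suc (suc ∣ A ∩ B ∣)            ∎)
    where
    open ≤-Reasoning
    A = φ zero
    w = φ (suc (suc zero))
    B = φ (suc (suc (suc (suc zero))))
    b≤1+∣A∩w∣ : b ≤ suc ∣ A ∩ w ∣
    b≤1+∣A∩w∣ = common-neighbour⇒overlap (size zero) (size (suc (suc zero)))
                  (φ (suc zero)) (size (suc zero)) (edge zero) (edge (suc zero))
    b≤1+∣w∩B∣ : b ≤ suc ∣ w ∩ B ∣
    b≤1+∣w∩B∣ = common-neighbour⇒overlap (size (suc (suc zero))) (size (suc (suc (suc (suc zero)))))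
                  (φ (suc (suc (suc zero)))) (size (suc (suc (suc zero))))
                  (edge (suc (suc zero))) (edge (suc (suc (suc zero))))

  middle-colour : {p q X : Subset (suc (2 * b))} → ∣ p ∣ ≡ b → ∣ q ∣ ≡ b → ∣ X ∣ ≡ b →
                  b ≤ suc ∣ X ∩ p ∣ → b ≤ suc ∣ X ∩ q ∣ →
                  Σ[ φ ∈ (Fin 5 → Subset (suc (2 * b))) ]
                    (IsColoring b 4 φ × φ zero ≡ p × φ (suc (suc (suc (suc zero)))) ≡ q × φ (suc (suc zero)) ≡ X)
  middle-colour {p} {q} {X} ∣p∣≡b ∣q∣≡b ∣X∣≡b b≤1+∣X∩p∣ b≤1+∣X∩q∣
    with overlap⇒common-neighbour ∣X∣≡b ∣p∣≡b b≤1+∣X∩p∣ | overlap⇒common-neighbour ∣X∣≡b ∣q∣≡b b≤1+∣X∩q∣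
  ... | u , ∣u∣≡b , X∩u≡⊥ , p∩u≡⊥ | v , ∣v∣≡b , X∩v≡⊥ , q∩v≡⊥ =
    lookup colours , (All.lookup⁺ {P = IsBSubset b} (∣p∣≡b ∷ ∣u∣≡b ∷ ∣X∣≡b ∷ ∣v∣≡b ∷ ∣q∣≡b ∷ []) , edge) ,
    refl , refl , refl
    where
    colours = p ∷ u ∷ X ∷ v ∷ q ∷ []
    edge : (i : Fin 4) → lookup colours (inject₁ i) ∩ lookup colours (suc i) ≡ ⊥
    edge zero                   = p∩u≡⊥
    edge (suc zero)             = trans (∩-comm u X) X∩u≡⊥
    edge (suc (suc zero))       = X∩v≡⊥
    edge (suc (suc (suc zero))) = trans (∩-comm v q) q∩v≡⊥

record Spread (b : ℕ) (X : Fin 4 → Subset n) : Set where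
  field
    size     : ∀ i → ∣ X i ∣ ≡ b
    distinct : ∀ i j → i ≢ j → X i ≢ X j
    overlap₁ : ∣ X zero ∩ X (suc zero) ∣ ≡ b ∸ 1
    overlap₂ : ∣ X zero ∩ X (suc (suc zero)) ∣ ≡ b ∸ 1
    overlap₃ : ∣ X zero ∩ X (suc (suc (suc zero))) ∣ ≡ b ∸ 2

module Exchanges {m : ℕ} (p : Subset n) (∣p∣≡2+m : ∣ p ∣ ≡ suc (suc m)) {x x′ y y′ : Fin n}
  (x≢x′ : x ≢ x′) (y≢y′ : y ≢ y′) (px : lookup p x ≡ inside) (px′ : lookup p x′ ≡ inside)
  (py : lookup p y ≡ outside) (py′ : lookup p y′ ≡ outside) where

  private
    b : ℕ
    b = suc (suc m)
    x≢y : x ≢ y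
    x≢y = ≢-indices {p = p} px py
    x≢y′ : x ≢ y′
    x≢y′ = ≢-indices {p = p} px py′
    x′≢y : x′ ≢ y
    x′≢y = ≢-indices {p = p} px′ py
    x′≢y′ : x′ ≢ y′
    x′≢y′ = ≢-indices {p = p} px′ py′

  E : Fin n → Fin n → Subset n
  E = exchange p

  ∣E∣≡b : ∀ u v → lookup p u ≡ inside → lookup p v ≡ outside → ∣ E u v ∣ ≡ b
  ∣E∣≡b u v pu pv = trans (∣exchange∣ p u v pu pv) ∣p∣≡2+m

  ∣E∩p∣≡1+m : ∀ u v → lookup p u ≡ inside → lookup p v ≡ outside → ∣ E u v ∩ p ∣ ≡ suc m
  ∣E∩p∣≡1+m u v pu pv = suc-injective (trans (1+∣exchange∩p∣ p u v pu pv) ∣p∣≡2+m)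

  ∣Exy∩Exy′∣≡1+m : ∣ E x y ∩ E x y′ ∣ ≡ suc m
  ∣Exy∩Exy′∣≡1+m = begin
    ∣ E x y ∩ E x y′ ∣  ≡⟨ exchange-∩-keeps p x y px py (E x y′)
                             (trans (lookup-exchange-removed p x y′ px py′)
                                    (sym (trans (lookup-exchange-other p x y′ (x≢y ∘ sym) y≢y′) py))) ⟩
    ∣ p ∩ E x y′ ∣      ≡⟨ cong ∣_∣ (∩-comm p _) ⟩
    ∣ E x y′ ∩ p ∣      ≡⟨ ∣E∩p∣≡1+m x y′ px py′ ⟩
    suc m               ∎
    where open ≡-Reasoning

  ∣Exy∩Ex′y∣≡1+m : ∣ E x y ∩ E x′ y ∣ ≡ suc m
  ∣Exy∩Ex′y∣≡1+m = begin
    ∣ E x y ∩ E x′ y ∣  ≡⟨ exchange-∩-keeps p x y px py (E x′ y)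
                             (trans (trans (lookup-exchange-other p x′ y x≢x′ x≢y) px)
                                    (sym (lookup-exchange-added p x′ y))) ⟩
    ∣ p ∩ E x′ y ∣      ≡⟨ cong ∣_∣ (∩-comm p _) ⟩
    ∣ E x′ y ∩ p ∣      ≡⟨ ∣E∩p∣≡1+m x′ y px′ py ⟩
    suc m               ∎
    where open ≡-Reasoning

  ∣Exy∩Ex′y′∣≡m : ∣ E x y ∩ E x′ y′ ∣ ≡ m
  ∣Exy∩Ex′y′∣≡m = suc-injective (begin
    suc ∣ E x y ∩ E x′ y′ ∣  ≡⟨ exchange-∩-loses p x y px py (E x′ y′)
                                  (trans (lookup-exchange-other p x′ y′ x≢x′ x≢y′) px)
                                  (trans (lookup-exchange-other p x′ y′ (x′≢y ∘ sym) y≢y′) py) ⟩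
    ∣ p ∩ E x′ y′ ∣          ≡⟨ cong ∣_∣ (∩-comm p _) ⟩
    ∣ E x′ y′ ∩ p ∣          ≡⟨ ∣E∩p∣≡1+m x′ y′ px′ py′ ⟩
    suc m                    ∎)
    where open ≡-Reasoning

  spread-with-third : (W : Subset n) → ∣ W ∣ ≡ b → ∣ E x y ∩ W ∣ ≡ suc m → E x y′ ≢ W →
                      Spread b (lookup (E x y ∷ E x y′ ∷ W ∷ E x′ y′ ∷ []))
  spread-with-third W ∣W∣≡b ∣Exy∩W∣≡1+m Exy′≢W = record
    { size     = All.lookup⁺ {P = λ X → ∣ X ∣ ≡ b}
                   (∣E∣≡b x y px py ∷ ∣E∣≡b x y′ px py′ ∷ ∣W∣≡b ∷ ∣E∣≡b x′ y′ px′ py′ ∷ [])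
    ; distinct = λ i j i≢j → i≢j ∘ lookup-injective unique i j
    ; overlap₁ = ∣Exy∩Exy′∣≡1+m
    ; overlap₂ = ∣Exy∩W∣≡1+m
    ; overlap₃ = ∣Exy∩Ex′y′∣≡m
    }
    where
    Exy≢ : ∀ {X k} → ∣ E x y ∩ X ∣ ≡ k → k < b → E x y ≢ X
    Exy≢ ∣Exy∩X∣≡k k<b = ∣p∩q∣<∣p∣⇒p≢q (subst₂ _<_ (sym ∣Exy∩X∣≡k) (sym (∣E∣≡b x y px py)) k<b)
    ≢Ex′y′ : ∀ {X} → ∣ E x y ∩ X ∣ ≡ suc m → X ≢ E x′ y′
    ≢Ex′y′ ∣Exy∩X∣≡1+m refl = <⇒≢ (n<1+n m) (trans (sym ∣Exy∩Ex′y′∣≡m) ∣Exy∩X∣≡1+m)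
    unique : Unique (E x y ∷ E x y′ ∷ W ∷ E x′ y′ ∷ [])
    unique = (Exy≢ ∣Exy∩Exy′∣≡1+m ≤-refl ∷ Exy≢ ∣Exy∩W∣≡1+m ≤-refl ∷ Exy≢ ∣Exy∩Ex′y′∣≡m (n≤1+n (suc m)) ∷ [])
           ∷ (Exy′≢W ∷ ≢Ex′y′ ∣Exy∩Exy′∣≡1+m ∷ [])
           ∷ (≢Ex′y′ ∣Exy∩W∣≡1+m ∷ [])
           ∷ [] ∷ []

  square-spread : Spread b (lookup (E x y ∷ E x y′ ∷ E x′ y ∷ E x′ y′ ∷ []))
  square-spread = spread-with-third (E x′ y) (∣E∣≡b x′ y px′ py) ∣Exy∩Ex′y∣≡1+m
    (≢-subsets (lookup-exchange-added p x y′) (trans (lookup-exchange-other p x′ y (x′≢y′ ∘ sym) (y≢y′ ∘ sym)) py′))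

  centred-spread : Spread b (lookup (E x y ∷ E x y′ ∷ p ∷ E x′ y′ ∷ []))
  centred-spread = spread-with-third p ∣p∣≡2+m (∣E∩p∣≡1+m x y px py) (≢-subsets (lookup-exchange-added p x y′) py′)

module _ {m : ℕ} {A B : Subset (suc (2 * suc (suc m)))}
         (∣A∣≡b : ∣ A ∣ ≡ suc (suc m)) (∣B∣≡b : ∣ B ∣ ≡ suc (suc m)) where

  private
    b : ℕ
    b = suc (suc m)

  Between : Subset (suc (2 * b)) → Set
  Between X = b ≤ suc ∣ X ∩ A ∣ × b ≤ suc ∣ X ∩ B ∣

  FourColours : Set
  FourColours = Σ[ X ∈ (Fin 4 → Subset (suc (2 * b))) ] (Spread b X × (∀ i → Between (X i)))

  between-exchange : ∀ x y → lookup A x ≡ inside → lookup A y ≡ outside → suc m ≤ ∣ exchange A x y ∩ B ∣ →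
                     Between (exchange A x y)
  between-exchange x y Ax Ay 1+m≤ = ≤-reflexive (sym (trans (1+∣exchange∩p∣ A x y Ax Ay) ∣A∣≡b)) , s≤s 1+m≤

  venn : ∀ d → d + ∣ A ∩ B ∣ ≡ b → ∣ A ∩ ∁ B ∣ ≡ d × ∣ ∁ A ∩ B ∣ ≡ d × d + ∣ ∁ A ∩ ∁ B ∣ ≡ suc b
  venn d d+k≡b = ∣A∩∁B∣≡d , ∣∁A∩B∣≡d , subst (λ c → c + ∣ ∁ A ∩ ∁ B ∣ ≡ suc b) ∣∁A∩B∣≡d ∣∁A∩B∣+∣∁A∩∁B∣≡1+b
    where
    open ≡-Reasoning
    ∣A∩∁B∣≡d : ∣ A ∩ ∁ B ∣ ≡ d
    ∣A∩∁B∣≡d = +-cancelʳ-≡ ∣ A ∩ B ∣ _ d (begin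
      ∣ A ∩ ∁ B ∣ + ∣ A ∩ B ∣  ≡⟨ +-comm ∣ A ∩ ∁ B ∣ ∣ A ∩ B ∣ ⟩
      ∣ A ∩ B ∣ + ∣ A ∩ ∁ B ∣  ≡⟨ ∣p∩q∣+∣p∩∁q∣≡∣p∣ A B ⟩
      ∣ A ∣                    ≡⟨ trans ∣A∣≡b (sym d+k≡b) ⟩
      d + ∣ A ∩ B ∣            ∎)
    ∣∁A∩B∣≡d : ∣ ∁ A ∩ B ∣ ≡ d
    ∣∁A∩B∣≡d = +-cancelʳ-≡ ∣ A ∩ B ∣ _ d (begin
      ∣ ∁ A ∩ B ∣ + ∣ A ∩ B ∣  ≡⟨ cong₂ (λ r s → ∣ r ∣ + ∣ s ∣) (∩-comm (∁ A) B) (∩-comm A B) ⟩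
      ∣ B ∩ ∁ A ∣ + ∣ B ∩ A ∣  ≡⟨ +-comm ∣ B ∩ ∁ A ∣ ∣ B ∩ A ∣ ⟩
      ∣ B ∩ A ∣ + ∣ B ∩ ∁ A ∣  ≡⟨ ∣p∩q∣+∣p∩∁q∣≡∣p∣ B A ⟩
      ∣ B ∣                    ≡⟨ trans ∣B∣≡b (sym d+k≡b) ⟩
      d + ∣ A ∩ B ∣            ∎)
    ∣∁A∩B∣+∣∁A∩∁B∣≡1+b : ∣ ∁ A ∩ B ∣ + ∣ ∁ A ∩ ∁ B ∣ ≡ suc b
    ∣∁A∩B∣+∣∁A∩∁B∣≡1+b = begin
      ∣ ∁ A ∩ B ∣ + ∣ ∁ A ∩ ∁ B ∣  ≡⟨ ∣p∩q∣+∣p∩∁q∣≡∣p∣ (∁ A) B ⟩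
      ∣ ∁ A ∣                      ≡⟨ ∣∁p∣≡n∸∣p∣ A ⟩
      suc (2 * b) ∸ ∣ A ∣          ≡⟨ cong (suc (2 * b) ∸_) ∣A∣≡b ⟩
      suc (b + (b + 0)) ∸ b        ≡⟨ cong (_∸ b) (sym (+-suc b (b + 0))) ⟩
      b + suc (b + 0) ∸ b          ≡⟨ m+n∸m≡n b _ ⟩
      suc (b + 0)                  ≡⟨ cong suc (+-identityʳ b) ⟩
      suc b                        ∎

  four-colours-when-∣A∩B∣≡b : ∣ A ∩ B ∣ ≡ b → FourColours
  four-colours-when-∣A∩B∣≡b k≡b
    with ∃₂-inRegions A B inside inside (subst (2 ≤_) (sym k≡b) (s≤s (s≤s z≤n)))
       | ∃₂-inRegions A B outside outside (subst (2 ≤_) (sym (proj₂ (proj₂ (venn 0 k≡b)))) (s≤s (s≤s z≤n)))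
  ... | x , x′ , x≢x′ , (Ax , Bx) , (Ax′ , Bx′) | y , y′ , y≢y′ , (Ay , By) , (Ay′ , By′) =
    _ , square-spread ,
    All.lookup⁺ {P = Between} (between x y Ax Bx Ay By ∷ between x y′ Ax Bx Ay′ By′
                             ∷ between x′ y Ax′ Bx′ Ay By ∷ between x′ y′ Ax′ Bx′ Ay′ By′ ∷ [])
    where
    open Exchanges A ∣A∣≡b x≢x′ y≢y′ Ax Ax′ Ay Ay′
    between : ∀ u v → lookup A u ≡ inside → lookup B u ≡ inside → lookup A v ≡ outside → lookup B v ≡ outside →
              Between (exchange A u v)
    between u v Au Bu Av Bv =
      between-exchange u v Au Av (≤-reflexive (sym (suc-injective (trans (exchange-∩-loses A u v Au Av B Bu Bv) k≡b))))

  four-colours-when-∣A∩B∣≡b-1 : ∣ A ∩ B ∣ ≡ suc m → FourColours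
  four-colours-when-∣A∩B∣≡b-1 k≡1+m
    with venn 1 (cong suc k≡1+m)
  ... | ∣A∩∁B∣≡1 , ∣∁A∩B∣≡1 , 1+∣∁A∩∁B∣≡1+b
    with ∃-inRegions A B inside outside (≤-reflexive (sym ∣A∩∁B∣≡1))
       | ∃-inRegions A B inside inside (subst (1 ≤_) (sym k≡1+m) (s≤s z≤n))
       | ∃-inRegions A B outside inside (≤-reflexive (sym ∣∁A∩B∣≡1))
       | ∃-inRegions A B outside outside (subst (1 ≤_) (sym (suc-injective 1+∣∁A∩∁B∣≡1+b)) (s≤s z≤n))
  ... | a , Aa , Ba | i , Ai , Bi | c , Ac , Bc | y , Ay , By =
    _ , centred-spread , All.lookup⁺ {P = Between} (between-a-y ∷ between-a-c ∷ between-A ∷ between-i-c ∷ [])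
    where
    open Exchanges A ∣A∣≡b (≢-indices {p = B} Bi Ba ∘ sym) (≢-indices {p = B} Bc By ∘ sym) Aa Ai Ay Ac
    between-a-y : Between (exchange A a y)
    between-a-y = between-exchange a y Aa Ay
      (≤-reflexive (sym (trans (exchange-∩-keeps A a y Aa Ay B (trans Ba (sym By))) k≡1+m)))
    between-a-c : Between (exchange A a c)
    between-a-c = between-exchange a c Aa Ac
      (subst (suc m ≤_) (sym (trans (exchange-∩-gains A a c Aa Ac B Ba Bc) (cong suc k≡1+m))) (n≤1+n (suc m)))
    between-A : Between A
    between-A = subst (b ≤_) (cong suc (sym (trans (cong ∣_∣ (∩-idem A)) ∣A∣≡b))) (n≤1+n b) , s≤s (≤-reflexive (sym k≡1+m))
    between-i-c : Between (exchange A i c)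
    between-i-c = between-exchange i c Ai Ac
      (≤-reflexive (sym (trans (exchange-∩-keeps A i c Ai Ac B (trans Bi (sym Bc))) k≡1+m)))

  four-colours-when-∣A∩B∣≡b-2 : ∣ A ∩ B ∣ ≡ m → FourColours
  four-colours-when-∣A∩B∣≡b-2 k≡m
    with venn 2 (cong (2 +_) k≡m)
  ... | ∣A∩∁B∣≡2 , ∣∁A∩B∣≡2 , _
    with ∃₂-inRegions A B inside outside (≤-reflexive (sym ∣A∩∁B∣≡2))
       | ∃₂-inRegions A B outside inside (≤-reflexive (sym ∣∁A∩B∣≡2))
  ... | x , x′ , x≢x′ , (Ax , Bx) , (Ax′ , Bx′) | y , y′ , y≢y′ , (Ay , By) , (Ay′ , By′) =
    _ , square-spread ,
    All.lookup⁺ {P = Between} (between x y Ax Bx Ay By ∷ between x y′ Ax Bx Ay′ By′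
                             ∷ between x′ y Ax′ Bx′ Ay By ∷ between x′ y′ Ax′ Bx′ Ay′ By′ ∷ [])
    where
    open Exchanges A ∣A∣≡b x≢x′ y≢y′ Ax Ax′ Ay Ay′
    between : ∀ u v → lookup A u ≡ inside → lookup B u ≡ outside → lookup A v ≡ outside → lookup B v ≡ inside →
              Between (exchange A u v)
    between u v Au Bu Av Bv =
      between-exchange u v Au Av (≤-reflexive (sym (trans (exchange-∩-gains A u v Au Av B Bu Bv) (cong suc k≡m))))

  four-colours : m ≤ ∣ A ∩ B ∣ → FourColours
  four-colours m≤k with m≤n⇒m<n∨m≡n m≤k
  ... | inj₂ m≡k = four-colours-when-∣A∩B∣≡b-2 (sym m≡k)
  ... | inj₁ m<k with m≤n⇒m<n∨m≡n m<k
  ...   | inj₂ 1+m≡k = four-colours-when-∣A∩B∣≡b-1 (sym 1+m≡k)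
  ...   | inj₁ 2+m≤k = four-colours-when-∣A∩B∣≡b (≤-antisym (subst (∣ A ∩ B ∣ ≤_) ∣A∣≡b (∣p∩q∣≤∣p∣ A B)) 2+m≤k)

lemma3 : (b : ℕ) → 2 ≤ b →
  (φ : Fin 5 → Subset (suc (2 * b))) → IsColoring b 4 φ →
  Σ[ X ∈ (Fin 4 → Subset (suc (2 * b))) ] (((i : Fin 4) → IsBSubset b (X i)) ×
    ((i j : Fin 4) → i ≢ j → X i ≢ X j) ×
    (∣ X zero ∩ X (suc zero) ∣ ≡ b ∸ 1) ×
    (∣ X zero ∩ X (suc (suc zero)) ∣ ≡ b ∸ 1) ×
    (∣ X zero ∩ X (suc (suc (suc zero))) ∣ ≡ b ∸ 2) ×
    ((i : Fin 4) → Σ[ φ′ ∈ (Fin 5 → Subset (suc (2 * b))) ] (IsColoring b 4 φ′ ×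
      (φ′ zero ≡ φ zero) ×
      (φ′ (suc (suc (suc (suc zero)))) ≡ φ (suc (suc (suc (suc zero))))) ×
      (φ′ (suc (suc zero)) ≡ X i))))
lemma3 zero () φ col
lemma3 (suc zero) (s≤s ()) φ col
lemma3 (suc (suc m)) _ φ col@(size , _) =
  let X , spread , between = four-colours ∣A∣≡b ∣B∣≡b (s≤s⁻¹ (s≤s⁻¹ (end-colours-overlap φ col))) in
  X , Spread.size spread , Spread.distinct spread ,
  Spread.overlap₁ spread , Spread.overlap₂ spread , Spread.overlap₃ spread ,
  λ i → middle-colour ∣A∣≡b ∣B∣≡b (Spread.size spread i) (proj₁ (between i)) (proj₂ (between i))
  where
  ∣A∣≡b = size zero
  ∣B∣≡b = size (suc (suc (suc (suc zero))))
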